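{- Let $G$ be a finite, simple, undirected, connected graph on $n\geq 4$ vertices that contains no triangle $K_3$ (as an induced subgraph) and has no pair of false-twin vertices. Then $G$ has at least $\lceil \frac{n}{2} \rceil$ bicliques.
   Context: All graphs are finite, simple, undirected and connected (standing assumption of the paper). A biclique of $G$ is a maximal (with respect to vertex-set inclusion) induced subgraph of $G$ that is a complete bipartite graph $K_{p,q}$ with $p,q\geq 1$; bicliques are counted as distinct vertex sets. Two distinct vertices $u,v$ are false-twins if $N(u)=N(v)$, where $N(\cdot)$ denotes the open neighborhood. -}

module Defs where

open import Data.Nat using (ℕ)
open import Data.Fin using (Fin)
open import Data.Fin.Subset using (Subset; _∈_; _∉_; _⊆_; _⊂_; Nonempty)
open import Data.Bool using (Bool; true; false)
open import Data.Product using (Σ; ∃; _×_; _,_)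
open import Data.Empty using (⊥)
open import Relation.Nullary using (¬_)
open import Relation.Binary.PropositionalEquality using (_≡_; _≢_)

record Graph (n : ℕ) : Set where
  field
    adj   : Fin n → Fin n → Bool
    sym   : ∀ u v → adj u v ≡ adj v u
    irrefl : ∀ u → adj u u ≡ false

open Graph public

module _ {n : ℕ} (G : Graph n) where

  Adj : Fin n → Fin n → Set
  Adj u v = adj G u v ≡ true

  data Walk : Fin n → Fin n → Set where
    nil  : ∀ {u} → Walk u u
    cons : ∀ {u v w} → Adj u v → Walk v w → Walk u w

  Connected : Set
  Connected = ∀ u v → Walk u v

  TriangleFree : Set
  TriangleFree = ∀ u v w → Adj u v → Adj v w → Adj u w → ⊥

  FalseTwins : Fin n → Fin n → Set
  FalseTwins u v = u ≢ v × (∀ w → adj G u w ≡ adj G v w)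

  NoFalseTwins : Set
  NoFalseTwins = ∀ u v → ¬ FalseTwins u v

  IsCompleteBipartiteSet : Subset n → Set
  IsCompleteBipartiteSet S =
    Σ (Subset n) λ A → Σ (Subset n) λ B →
      Nonempty A × Nonempty B ×
      (∀ x → x ∈ S → (x ∈ A × x ∉ B) ⊎' (x ∈ B × x ∉ A)) ×
      A ⊆ S × B ⊆ S ×
      (∀ a a' → a ∈ A → a' ∈ A → ¬ Adj a a') ×
      (∀ b b' → b ∈ B → b' ∈ B → ¬ Adj b b') ×
      (∀ a b → a ∈ A → b ∈ B → Adj a b)
    where
      open import Data.Sum renaming (_⊎_ to _⊎'_)

  IsBiclique : Subset n → Set
  IsBiclique S = IsCompleteBipartiteSet S ×
                 (∀ T → S ⊂ T → ¬ IsCompleteBipartiteSet T)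

-- For a vertex v with a neighbour, the vertices u with N(v) ⊆ N(u), together with N(v),
-- form a biclique of a triangle-free graph. If two distinct vertices give the same biclique,
-- each lies in the other's biclique, so either one neighbourhood contains the other in both
-- directions (false twins, excluded) or they are adjacent. Three vertices with one biclique
-- would therefore form a triangle, so v ↦ biclique(v) is at most two-to-one and has at least
-- ⌈n/2⌉ distinct values.
module Submission where

open import Defs
open import Data.Bool using (Bool; true)
import Data.Bool.Properties as Bool
open import Data.Empty using (⊥; ⊥-elim)
open import Data.Fin using (Fin) renaming (zero to fzero; suc to fsuc)
open import Data.Fin.Subset using (Subset; _∈_; _∉_; _⊆_; _⊂_; _∪_)
open import Data.Fin.Subset.Properties using (_⊆?_; ⊆-refl; ⊆-antisym; x∈p∪q⁺; x∈p∪q⁻)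
open import Data.List using (List; []; _∷_; length; map; filter; allFin)
open import Data.List.Properties using (length-filter; length-tabulate)
open import Data.List.Membership.Propositional using () renaming (_∈_ to _∈ₗ_)
open import Data.List.Membership.Propositional.Properties using (∈-filter⁻; ∈-map⁻)
open import Data.List.Relation.Binary.Subset.Propositional using () renaming (_⊆_ to _⊆ₗ_)
open import Data.List.Relation.Binary.Subset.Propositional.Properties
  using (⊆-trans; filter-⊆; xs⊆x∷xs; map⁺)
open import Data.List.Relation.Unary.All using (All; _∷_)
import Data.List.Relation.Unary.All as All
open import Data.List.Relation.Unary.All.Properties using (¬Any⇒All¬)
open import Data.List.Relation.Unary.Any using (here; there)
open import Data.List.Relation.Unary.Unique.Propositional using (Unique; []; _∷_)
open import Data.List.Relation.Unary.Unique.Propositional.Properties using (filter⁺; allFin⁺)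
open import Data.Nat using (ℕ; suc; _+_; _*_; _≤_; z≤n; s≤s; ⌈_/2⌉)
open import Data.Nat.Properties
  using (≤-refl; ≤-trans; +-mono-≤; +-suc; *-suc; +-identityʳ; ⌈n/2⌉-mono; n≡⌈n+n/2⌉; module ≤-Reasoning)
open import Data.Product using (Σ; ∃; _×_; _,_; proj₁; proj₂)
open import Data.Sum using (_⊎_; inj₁; inj₂; swap)
import Data.Sum as Sum
open import Data.Vec using (tabulate; lookup)
open import Data.Vec.Properties using (≡-dec; lookup∘tabulate; []=⇒lookup; lookup⇒[]=)
open import Function using (_∘_; flip; id)
open import Level using (0ℓ)
open import Relation.Binary.Definitions using (DecidableEquality)
open import Relation.Binary.PropositionalEquality
  using (_≡_; _≢_; refl; trans; cong; subst; module ≡-Reasoning)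
  renaming (sym to ≡-sym)
open import Relation.Nullary using (¬_; Dec; yes; no; does)
open import Relation.Nullary.Decidable using (dec-true)
open import Relation.Unary using (Pred; Decidable)
open import Relation.Unary.Properties using (∁?)

length-filter+length-filter-∁ : {A : Set} {P : Pred A 0ℓ} (P? : Decidable P) (xs : List A) →
  length (filter P? xs) + length (filter (∁? P?) xs) ≡ length xs
length-filter+length-filter-∁ P? [] = refl
length-filter+length-filter-∁ P? (x ∷ xs) with P? x
... | yes _ = cong suc (length-filter+length-filter-∁ P? xs)
... | no _  = trans (+-suc _ _) (cong suc (length-filter+length-filter-∁ P? xs))

Unique∧no-distinct-pair⇒length≤1 : {A : Set} {ys : List A} → Unique ys →
  (∀ {y z} → y ∈ₗ ys → z ∈ₗ ys → y ≢ z → ⊥) → length ys ≤ 1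
Unique∧no-distinct-pair⇒length≤1 {ys = []}         _                 _ = z≤n
Unique∧no-distinct-pair⇒length≤1 {ys = _ ∷ []}     _                 _ = s≤s z≤n
Unique∧no-distinct-pair⇒length≤1 {ys = _ ∷ _ ∷ _} ((y≢z ∷ _) ∷ _) distinct =
  ⊥-elim (distinct (here refl) (there (here refl)) y≢z)

module _ {A B : Set} (f : A → B) where

  AtMostTwoToOne : List A → Set
  AtMostTwoToOne xs = ∀ {x y z} → x ∈ₗ xs → y ∈ₗ xs → z ∈ₗ xs →
    x ≢ y → y ≢ z → x ≢ z → f x ≡ f y → f y ≡ f z → ⊥

  AtMostTwoToOne-⊆ : ∀ {xs ys} → xs ⊆ₗ ys → AtMostTwoToOne ys → AtMostTwoToOne xs
  AtMostTwoToOne-⊆ xs⊆ys two x∈ y∈ z∈ = two (xs⊆ys x∈) (xs⊆ys y∈) (xs⊆ys z∈)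

  HalfSizeImage : List A → Set
  HalfSizeImage xs = ∃ λ bs → Unique bs × bs ⊆ₗ map f xs × length xs ≤ 2 * length bs

  -- Take the image of the head and discard its fibre, which has at most one further element.
  -- The recursion is on a fuel bound for the length, since filtering is not structural.
  private
    halfSizeImage-fuel : DecidableEquality B → ∀ k xs → length xs ≤ k →
      Unique xs → AtMostTwoToOne xs → HalfSizeImage xs
    halfSizeImage-fuel _   _       []       _            _            _   = [] , [] , (λ ()) , z≤n
    halfSizeImage-fuel _≟_ (suc k) (x ∷ xs) (s≤s |xs|≤k) (x∉xs ∷ uxs) two =
      extend (halfSizeImage-fuel _≟_ k rest (≤-trans (length-filter _ xs) |xs|≤k) (filter⁺ _ uxs)
                (AtMostTwoToOne-⊆ rest⊆x∷xs two))
      where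
        sameImage? : Decidable (λ y → f y ≡ f x)
        sameImage? y = f y ≟ f x

        same rest : List A
        same = filter sameImage? xs
        rest = filter (∁? sameImage?) xs

        rest⊆x∷xs : rest ⊆ₗ x ∷ xs
        rest⊆x∷xs = ⊆-trans (filter-⊆ _ xs) (xs⊆x∷xs xs x)

        |same|≤1 : length same ≤ 1
        |same|≤1 = Unique∧no-distinct-pair⇒length≤1 (filter⁺ _ uxs) λ y∈ z∈ y≢z →
          let (y∈xs , fy≡fx) = ∈-filter⁻ sameImage? {xs = xs} y∈
              (z∈xs , fz≡fx) = ∈-filter⁻ sameImage? {xs = xs} z∈
          in two (here refl) (there y∈xs) (there z∈xs)
                 (All.lookup x∉xs y∈xs) y≢z (All.lookup x∉xs z∈xs)
                 (≡-sym fy≡fx) (trans fy≡fx (≡-sym fz≡fx))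

        fx∉image-rest : ∀ {bs} → bs ⊆ₗ map f rest → All (f x ≢_) bs
        fx∉image-rest {bs} bs⊆ = ¬Any⇒All¬ bs λ fx∈bs →
          let (y , y∈rest , fx≡fy) = ∈-map⁻ f (bs⊆ fx∈bs)
          in proj₂ (∈-filter⁻ (∁? sameImage?) {xs = xs} y∈rest) (≡-sym fx≡fy)

        extend : HalfSizeImage rest → HalfSizeImage (x ∷ xs)
        extend (bs , ubs , bs⊆ , |rest|≤2|bs|) =
          f x ∷ bs , fx∉image-rest bs⊆ ∷ ubs , ∷-⊆ , bound
          where
            ∷-⊆ : f x ∷ bs ⊆ₗ map f (x ∷ xs)
            ∷-⊆ (here refl) = here refl
            ∷-⊆ (there b∈)  = map⁺ f rest⊆x∷xs (bs⊆ b∈)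

            open ≤-Reasoning
            bound : suc (length xs) ≤ 2 * suc (length bs)
            bound = begin
              suc (length xs)                  ≡⟨ cong suc (≡-sym (length-filter+length-filter-∁ sameImage? xs)) ⟩
              suc (length same + length rest)  ≤⟨ s≤s (+-mono-≤ |same|≤1 |rest|≤2|bs|) ⟩
              2 + 2 * length bs                ≡⟨ ≡-sym (*-suc 2 (length bs)) ⟩
              2 * suc (length bs)              ∎

  halfSizeImage : DecidableEquality B → ∀ xs → Unique xs → AtMostTwoToOne xs → HalfSizeImage xs
  halfSizeImage _≟_ xs = halfSizeImage-fuel _≟_ (length xs) xs ≤-refl

⌈n/2⌉≤m : ∀ {n m} → n ≤ 2 * m → ⌈ n /2⌉ ≤ m
⌈n/2⌉≤m {n} {m} n≤2m = subst (⌈ n /2⌉ ≤_) (≡-sym (n≡⌈n+n/2⌉ m))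
  (⌈n/2⌉-mono (subst (λ k → n ≤ m + k) (+-identityʳ m) n≤2m))

module _ {n : ℕ} (g : Fin n → Bool) where

  ∈-tabulate⁺ : ∀ {x} → g x ≡ true → x ∈ tabulate g
  ∈-tabulate⁺ {x} gx = lookup⇒[]= x (tabulate g) (trans (lookup∘tabulate g x) gx)

  ∈-tabulate⁻ : ∀ {x} → x ∈ tabulate g → g x ≡ true
  ∈-tabulate⁻ {x} x∈ = trans (≡-sym (lookup∘tabulate g x)) ([]=⇒lookup x∈)

does-true⇒ : {P : Set} (P? : Dec P) → does P? ≡ true → P
does-true⇒ (yes p) _ = p

module _ {n : ℕ} (G : Graph n) where

  nbhd : Fin n → Subset n
  nbhd v = tabulate (adj G v)

  dominators : Fin n → Subset n
  dominators v = tabulate (λ u → does (nbhd v ⊆? nbhd u))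

  bicliqueAt : Fin n → Subset n
  bicliqueAt v = dominators v ∪ nbhd v

  Independent : Subset n → Set
  Independent X = ∀ a a' → a ∈ X → a' ∈ X → ¬ Adj G a a'

  CompleteBetween : Subset n → Subset n → Set
  CompleteBetween X Y = ∀ a b → a ∈ X → b ∈ Y → Adj G a b

  ∈-dominators⁺ : ∀ {v u} → nbhd v ⊆ nbhd u → u ∈ dominators v
  ∈-dominators⁺ {v} {u} Nv⊆Nu = ∈-tabulate⁺ _ (dec-true (nbhd v ⊆? nbhd u) Nv⊆Nu)

  ∈-dominators⁻ : ∀ {v u} → u ∈ dominators v → nbhd v ⊆ nbhd u
  ∈-dominators⁻ {v} {u} u∈ = does-true⇒ (nbhd v ⊆? nbhd u) (∈-tabulate⁻ _ u∈)

  ∈-bicliqueAt⁺ : ∀ {v u} → nbhd v ⊆ nbhd u ⊎ Adj G v u → u ∈ bicliqueAt v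
  ∈-bicliqueAt⁺ = x∈p∪q⁺ ∘ Sum.map ∈-dominators⁺ (∈-tabulate⁺ _)

  ∈-bicliqueAt⁻ : ∀ {v u} → u ∈ bicliqueAt v → nbhd v ⊆ nbhd u ⊎ Adj G v u
  ∈-bicliqueAt⁻ {v} = Sum.map ∈-dominators⁻ (∈-tabulate⁻ _) ∘ x∈p∪q⁻ (dominators v) (nbhd v)

  v∈bicliqueAt : ∀ v → v ∈ bicliqueAt v
  v∈bicliqueAt v = ∈-bicliqueAt⁺ (inj₁ ⊆-refl)

  equal-nbhds⇒FalseTwins : ∀ {v w} → v ≢ w → nbhd v ≡ nbhd w → FalseTwins G v w
  equal-nbhds⇒FalseTwins {v} {w} v≢w Nv≡Nw = v≢w , λ z → begin
    adj G v z            ≡⟨ ≡-sym (lookup∘tabulate (adj G v) z) ⟩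
    lookup (nbhd v) z    ≡⟨ cong (flip lookup z) Nv≡Nw ⟩
    lookup (nbhd w) z    ≡⟨ lookup∘tabulate (adj G w) z ⟩
    adj G w z            ∎
    where open ≡-Reasoning

  bicliqueAt-isCompleteBipartiteSet : TriangleFree G → ∀ {v} → ∃ (Adj G v) →
    IsCompleteBipartiteSet G (bicliqueAt v)
  bicliqueAt-isCompleteBipartiteSet tf {v} (b , v~b) =
    dominators v , nbhd v , (v , ∈-dominators⁺ ⊆-refl) , (b , ∈-tabulate⁺ _ v~b) ,
    partition , (λ u∈ → x∈p∪q⁺ (inj₁ u∈)) , (λ u∈ → x∈p∪q⁺ (inj₂ u∈)) ,
    dominators-independent , nbhd-independent , complete
    where
      complete : CompleteBetween (dominators v) (nbhd v)
      complete a b' a∈ b'∈ = ∈-tabulate⁻ _ (∈-dominators⁻ a∈ b'∈)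

      disjoint : ∀ u → u ∈ dominators v → u ∉ nbhd v
      disjoint u u∈D u∈N with () ← trans (≡-sym (complete u u u∈D u∈N)) (irrefl G u)

      partition : ∀ x → x ∈ bicliqueAt v →
        (x ∈ dominators v × x ∉ nbhd v) ⊎ (x ∈ nbhd v × x ∉ dominators v)
      partition x x∈ with x∈p∪q⁻ (dominators v) (nbhd v) x∈
      ... | inj₁ x∈D = inj₁ (x∈D , disjoint x x∈D)
      ... | inj₂ x∈N = inj₂ (x∈N , λ x∈D → disjoint x x∈D x∈N)

      -- Two adjacent dominators would form a triangle with the neighbour b of v.
      dominators-independent : Independent (dominators v)
      dominators-independent a a' a∈ a'∈ a~a' =
        tf a a' b a~a' (complete a' b a'∈ b∈N) (complete a b a∈ b∈N)
        where
          b∈N : b ∈ nbhd v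
          b∈N = ∈-tabulate⁺ (adj G v) v~b

      nbhd-independent : Independent (nbhd v)
      nbhd-independent b₁ b₂ b₁∈ b₂∈ b₁~b₂ =
        tf v b₁ b₂ (∈-tabulate⁻ _ b₁∈) b₁~b₂ (∈-tabulate⁻ _ b₂∈)

  -- Any neighbour w of v lies on the side opposite to v, hence is adjacent to every x on v's side.
  completeBipartite⊆bicliqueAt : ∀ {v} X Y T → (∀ x → x ∈ T → x ∈ X ⊎ x ∈ Y) →
    Independent X → CompleteBetween X Y → v ∈ X → nbhd v ⊆ T → T ⊆ bicliqueAt v
  completeBipartite⊆bicliqueAt {v} X Y T partition indX complete v∈X Nv⊆T {x} x∈T
    with partition x x∈T
  ... | inj₂ x∈Y = ∈-bicliqueAt⁺ (inj₂ (complete v x v∈X x∈Y))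
  ... | inj₁ x∈X = ∈-bicliqueAt⁺ (inj₁ Nv⊆Nx)
    where
      Nv⊆Nx : nbhd v ⊆ nbhd x
      Nv⊆Nx {w} w∈Nv with partition w (Nv⊆T w∈Nv)
      ... | inj₁ w∈X = ⊥-elim (indX v w v∈X w∈X (∈-tabulate⁻ _ w∈Nv))
      ... | inj₂ w∈Y = ∈-tabulate⁺ _ (complete x w x∈X w∈Y)

  bicliqueAt-maximal : ∀ v T → bicliqueAt v ⊂ T → ¬ IsCompleteBipartiteSet G T
  bicliqueAt-maximal v T (S⊆T , x , x∈T , x∉S)
                         (X , Y , _ , _ , partition , _ , _ , indX , indY , complete) =
    x∉S (T⊆S x∈T)
    where
      sides : ∀ y → y ∈ T → y ∈ X ⊎ y ∈ Y
      sides y = Sum.map proj₁ proj₁ ∘ partition y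

      Nv⊆T : nbhd v ⊆ T
      Nv⊆T = S⊆T ∘ ∈-bicliqueAt⁺ ∘ inj₂ ∘ ∈-tabulate⁻ _

      T⊆S : T ⊆ bicliqueAt v
      T⊆S with sides v (S⊆T (v∈bicliqueAt v))
      ... | inj₁ v∈X = completeBipartite⊆bicliqueAt X Y T sides indX complete v∈X Nv⊆T
      ... | inj₂ v∈Y = completeBipartite⊆bicliqueAt Y X T (λ y → swap ∘ sides y) indY
                         (λ a b a∈Y b∈X → trans (sym G a b) (complete b a b∈X a∈Y)) v∈Y Nv⊆T

  bicliqueAt-isBiclique : TriangleFree G → ∀ {v} → ∃ (Adj G v) → IsBiclique G (bicliqueAt v)
  bicliqueAt-isBiclique tf {v} nb = bicliqueAt-isCompleteBipartiteSet tf nb , bicliqueAt-maximal v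

  bicliqueAt-≡⇒Adj : NoFalseTwins G → ∀ {v w} → v ≢ w → bicliqueAt v ≡ bicliqueAt w → Adj G v w
  bicliqueAt-≡⇒Adj nft {v} {w} v≢w Sv≡Sw
    with ∈-bicliqueAt⁻ (subst (w ∈_) (≡-sym Sv≡Sw) (v∈bicliqueAt w))
       | ∈-bicliqueAt⁻ (subst (v ∈_) Sv≡Sw (v∈bicliqueAt v))
  ... | inj₂ v~w   | _          = v~w
  ... | inj₁ _     | inj₂ w~v   = trans (sym G v w) w~v
  ... | inj₁ Nv⊆Nw | inj₁ Nw⊆Nv =
    ⊥-elim (nft v w (equal-nbhds⇒FalseTwins v≢w (⊆-antisym Nv⊆Nw Nw⊆Nv)))

  bicliqueAt-atMostTwoToOne : TriangleFree G → NoFalseTwins G → ∀ {xs} → AtMostTwoToOne bicliqueAt xs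
  bicliqueAt-atMostTwoToOne tf nft {_} {x} {y} {z} _ _ _ x≢y y≢z x≢z Sx≡Sy Sy≡Sz =
    tf x y z (bicliqueAt-≡⇒Adj nft x≢y Sx≡Sy) (bicliqueAt-≡⇒Adj nft y≢z Sy≡Sz)
             (bicliqueAt-≡⇒Adj nft x≢z (trans Sx≡Sy Sy≡Sz))

  walk⇒neighbour : ∀ {v u} → Walk G v u → v ≢ u → ∃ (Adj G v)
  walk⇒neighbour nil              v≢v = ⊥-elim (v≢v refl)
  walk⇒neighbour (cons v~w _) _   = _ , v~w

connected⇒neighbour : ∀ {n} (G : Graph (suc (suc n))) → Connected G → ∀ v → ∃ (Adj G v)
connected⇒neighbour G con fzero    = walk⇒neighbour G (con fzero (fsuc fzero)) (λ ())
connected⇒neighbour G con (fsuc v) = walk⇒neighbour G (con (fsuc v) fzero) (λ ())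

theorem4p5 : (n : ℕ) → 4 ≤ n → (G : Graph n) →
    Connected G → TriangleFree G → NoFalseTwins G →
    Σ (List (Subset n)) λ bs →
    Unique bs × All (IsBiclique G) bs × ⌈ n /2⌉ ≤ length bs
theorem4p5 n@(suc (suc _)) (s≤s (s≤s _)) G con tf nft =
  conclude (halfSizeImage (bicliqueAt G) (≡-dec Bool._≟_) (allFin n) (allFin⁺ n)
             (bicliqueAt-atMostTwoToOne G tf nft))
  where
    conclude : HalfSizeImage (bicliqueAt G) (allFin n) →
      Σ (List (Subset n)) λ bs → Unique bs × All (IsBiclique G) bs × ⌈ n /2⌉ ≤ length bs
    conclude (bs , unique , bs⊆image , n≤2|bs|) =
      bs , unique , All.tabulate isBiclique ,
      ⌈n/2⌉≤m (subst (_≤ 2 * length bs) (length-tabulate id) n≤2|bs|)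
      where
        isBiclique : ∀ {b} → b ∈ₗ bs → IsBiclique G b
        isBiclique b∈ with ∈-map⁻ (bicliqueAt G) (bs⊆image b∈)
        ... | v , _ , refl = bicliqueAt-isBiclique G tf (connected⇒neighbour G con v)
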